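{- Let $T$ be either an arborescence or an anti-arborescence. Then $T$ admits a unique independent dominating set.
   Context: An arborescence (out-tree) is an orientation of a finite tree having a root vertex $r$ such that every arc is directed away from $r$ (every vertex is reachable from $r$ by a directed path). An anti-arborescence (in-tree) is the reversal of an arborescence (all arcs directed toward the root). In a digraph $D$, a set $S\subseteq V(D)$ is an independent dominating set if no arc of $D$ joins two vertices of $S$ and every vertex $u\in V(D)\setminus S$ has some $v\in S$ with $vu\in A(D)$. -}

module Defs where

open import Data.Nat using (ℕ; _≤_)
open import Data.Fin using (Fin)
open import Data.Fin.Subset using (Subset; _∈_; _∉_)
open import Data.List using (List; _∷_; []; _++_; [_]; length)
open import Data.List.Relation.Unary.Linked using (Linked)
open import Data.List.Relation.Unary.Unique.Propositional using (Unique)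
open import Data.Product using (Σ; ∃; _×_; _,_)
open import Data.Sum using (_⊎_)
open import Relation.Nullary using (¬_)
open import Relation.Binary.Construct.Closure.ReflexiveTransitive using (Star)

-- A (finite) digraph on vertex set Fin n is given by its arc relation:
-- A u v  means there is an arc u → v.
Digraph : ℕ → Set₁
Digraph n = Fin n → Fin n → Set

reverse : ∀ {n} → Digraph n → Digraph n
reverse A u v = A v u

Adj : ∀ {n} → Digraph n → Fin n → Fin n → Set
Adj A u v = A u v ⊎ A v u

IsOrientation : ∀ {n} → Digraph n → Set
IsOrientation A = (∀ u → ¬ A u u) × (∀ u v → A u v → ¬ A v u)

-- A cycle in the underlying undirected graph: distinct vertices
-- x , x₁ , … , x_k  (k ≥ 2) with consecutive ones adjacent and x_k adjacent to x.
HasUndirectedCycle : ∀ {n} → Digraph n → Set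
HasUndirectedCycle {n} A =
  Σ (Fin n) λ x → Σ (List (Fin n)) λ xs →
    (2 ≤ length xs) × Unique (x ∷ xs) × Linked (Adj A) (x ∷ xs ++ [ x ])

-- Arborescence with root r: an orientation of a tree (underlying graph
-- acyclic; connectedness follows from reachability) in which every vertex
-- is reachable from r by a directed path.
IsArborescence : ∀ {n} → Digraph n → Fin n → Set
IsArborescence A r =
  IsOrientation A × ¬ HasUndirectedCycle A × (∀ v → Star A r v)

IsAntiArborescence : ∀ {n} → Digraph n → Fin n → Set
IsAntiArborescence A r = IsArborescence (reverse A) r

IsIndependent : ∀ {n} → Digraph n → Subset n → Set
IsIndependent A S = ∀ u v → u ∈ S → v ∈ S → ¬ A u v

IsDominating : ∀ {n} → Digraph n → Subset n → Set
IsDominating {n} A S = ∀ u → u ∉ S → Σ (Fin n) λ v → v ∈ S × A v u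

IsIndependentDominating : ∀ {n} → Digraph n → Subset n → Set
IsIndependentDominating A S = IsIndependent A S × IsDominating A S

module Submission where

-- Only one property of these digraphs matters: they are orientations of
-- forests.  The proof has two independent halves.
--
--  * Orientations of forests are well founded (no infinite backward chain of
--    arcs).  A directed cycle would be an undirected cycle of length ≥ 3 or a
--    pair of opposite arcs; so no arc enters the start of a simple directed
--    path from a vertex of that path, and since simple paths in a finite
--    digraph have at most n vertices, backward exploration must terminate.
--
--  * Every decidable well-founded digraph has a unique kernel.  Uniqueness is
--    well-founded induction: two kernels agreeing on the in-neighbours of v
--    agree on v.  Existence defines membership by well-founded recursion:
--    v is in the kernel iff none of its in-neighbours is.
--
-- The anti-arborescence case reduces to the first half by reversal, since
-- reversing arcs preserves being an orientation of a forest.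

open import Defs
open import Data.Bool using (Bool; true; false; not; T)
open import Data.Bool.ListAction using (any; or)
open import Data.Bool.Properties using (T-≡)
open import Data.Empty using (⊥; ⊥-elim)
open import Data.Fin using (Fin; zero; suc)
open import Data.Fin.Properties using (injective⇒≤)
open import Data.Fin.Subset using (Subset; _∈_)
open import Data.Fin.Subset.Properties using (⊆-antisym; _∈?_)
open import Data.List using (List; []; _∷_; _++_; [_]; length; lookup; allFin)
open import Data.List.Properties using (map-cong; ++-assoc; length-++)
open import Data.List.Membership.Propositional using (lose) renaming (_∉_ to _∉ₗ_)
open import Data.List.Membership.Propositional.Properties using (∈-lookup; ∈-allFin; ∈-∃++)
open import Data.List.Relation.Unary.All as All using ([]; _∷_)
open import Data.List.Relation.Unary.All.Properties using (¬Any⇒All¬; ++⁻ˡ)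
open import Data.List.Relation.Unary.AllPairs using ([]; _∷_)
open import Data.List.Relation.Unary.Any using (here; there; satisfied)
open import Data.List.Relation.Unary.Any.Properties using (any⁺; any⁻)
open import Data.List.Relation.Unary.Linked using (Linked; []; [-]; _∷_) renaming (map to mapLinked)
open import Data.List.Relation.Unary.Unique.Propositional using (Unique)
open import Data.Nat using (ℕ; zero; suc; _+_; _≤_; s≤s)
open import Data.Nat.Properties using (+-suc; m≤m+n; m≤n+m; 1+n≰n; ≤-trans)
open import Data.Product using (Σ; ∃; ∃!; _×_; _,_; proj₁; proj₂)
open import Data.Sum using (_⊎_; inj₁; inj₂; swap)
open import Data.Vec using (tabulate)
open import Data.Vec.Properties using ([]=⇒lookup; lookup⇒[]=; lookup∘tabulate)
open import Function using (_∘_)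
open import Function.Bundles using (Equivalence)
open import Induction.WellFounded as WF using (WellFounded; Acc; acc; WfRec; module FixPoint)
open import Level using (0ℓ)
open import Relation.Binary using (Rel; Decidable)
open import Relation.Binary.PropositionalEquality using (_≡_; refl; sym; trans; cong; subst)
open import Relation.Nullary using (¬_; yes; no)

module _ {a r} {X : Set a} {R : Rel X r} where

  Linked-prefix : ∀ (xs : List X) {ys} → Linked R (xs ++ ys) → Linked R xs
  Linked-prefix []           _             = []
  Linked-prefix (x ∷ [])     _             = [-]
  Linked-prefix (x ∷ y ∷ xs) (xRy ∷ chain) = xRy ∷ Linked-prefix (y ∷ xs) chain

  Linked-snoc : ∀ {x} (xs : List X) {y z} →
    Linked R (x ∷ xs ++ [ y ]) → R y z → Linked R (x ∷ (xs ++ [ y ]) ++ [ z ])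
  Linked-snoc []       (xRy ∷ [-])   yRz = xRy ∷ yRz ∷ [-]
  Linked-snoc (_ ∷ xs) (xRw ∷ chain) yRz = xRw ∷ Linked-snoc xs chain yRz

module _ {a} {X : Set a} where

  Unique-prefix : ∀ (xs : List X) {ys} → Unique (xs ++ ys) → Unique xs
  Unique-prefix []       _               = []
  Unique-prefix (x ∷ xs) (x∉rest ∷ uniq) = ++⁻ˡ xs x∉rest ∷ Unique-prefix xs uniq

  lookup-injective : ∀ {xs : List X} → Unique xs → ∀ {i j} → lookup xs i ≡ lookup xs j → i ≡ j
  lookup-injective (_    ∷ _)    {zero}  {zero}  _  = refl
  lookup-injective (x∉xs ∷ _)    {zero}  {suc j} eq = ⊥-elim (All.lookup x∉xs (∈-lookup j) eq)
  lookup-injective (x∉xs ∷ _)    {suc i} {zero}  eq = ⊥-elim (All.lookup x∉xs (∈-lookup i) (sym eq))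
  lookup-injective (_    ∷ uniq) {suc i} {suc j} eq = cong suc (lookup-injective uniq eq)

unique⇒length≤ : ∀ {n} {xs : List (Fin n)} → Unique xs → length xs ≤ n
unique⇒length≤ uniq = injective⇒≤ (lookup-injective uniq)

-- Absence of directed cycles, phrased through simple paths: no arc enters the
-- first vertex of a simple directed path from a vertex lying on that path.
DirectedAcyclic : ∀ {n} → Digraph n → Set
DirectedAcyclic R = ∀ {v w u} → Linked R (v ∷ w) → Unique (v ∷ w) → R u v → u ∉ₗ v ∷ w

-- In a finite digraph without directed cycles every vertex is accessible:
-- exploring arcs backwards grows a simple path, which cannot exceed n vertices.
directedAcyclic⇒wellFounded : ∀ {n} {R : Digraph n} → DirectedAcyclic R → WellFounded R
directedAcyclic⇒wellFounded {n} {R} acyclic v = extend n [-] ([] ∷ []) (m≤m+n n 0)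
  where
  -- The head of a simple path v ∷ w is accessible.  Invariant: adding k more
  -- vertices would exceed n vertices, so the fuel k bounds the exploration.
  extend : ∀ k {v w} → Linked R (v ∷ w) → Unique (v ∷ w) → n ≤ k + length w → Acc R v
  extend zero    _ uniq room = ⊥-elim (1+n≰n (≤-trans (unique⇒length≤ uniq) room))
  extend (suc k) {v} {w} path uniq room = acc λ uv →
    extend k (uv ∷ path) (¬Any⇒All¬ (v ∷ w) (acyclic path uniq uv) ∷ uniq)
      (subst (n ≤_) (sym (+-suc k (length w))) room)

-- An orientation of a forest has no directed cycles: an arc u → v closing a
-- directed path v ⇝ u is a loop, a pair of opposite arcs, or else yields an
-- undirected cycle of length at least three.
orientedForest⇒directedAcyclic : ∀ {n} {A : Digraph n} →
  IsOrientation A → ¬ HasUndirectedCycle A → DirectedAcyclic A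
orientedForest⇒directedAcyclic (noLoop , _) _ {v} _ _ uv (here refl) =
  noLoop v uv
orientedForest⇒directedAcyclic {A = A} (_ , noDigon) noCycle {v} {w} {u} path uniq uv (there u∈w)
  with pre , post , refl ← ∈-∃++ u∈w =
  closeCycle pre (Linked-prefix (v ∷ pre ++ [ u ]) (subst (Linked A) reassoc path))
                 (Unique-prefix (v ∷ pre ++ [ u ]) (subst Unique reassoc uniq))
  where
  reassoc : v ∷ pre ++ [ u ] ++ post ≡ (v ∷ pre ++ [ u ]) ++ post
  reassoc = cong (v ∷_) (sym (++-assoc pre [ u ] post))

  closeCycle : ∀ pre → Linked A (v ∷ pre ++ [ u ]) → Unique (v ∷ pre ++ [ u ]) → ⊥
  closeCycle []        (vu ∷ [-]) _     = noDigon u v uv vu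
  closeCycle (x ∷ pre) cycle      uniq′ =
    noCycle (v , x ∷ pre ++ [ u ] , s≤s atLeastOne , uniq′ ,
             Linked-snoc (x ∷ pre) (mapLinked inj₁ cycle) (inj₁ uv))
    where
    atLeastOne : 1 ≤ length (pre ++ [ u ])
    atLeastOne = subst (1 ≤_) (sym (length-++ pre)) (m≤n+m 1 (length pre))

orientedForest⇒wellFounded : ∀ {n} {A : Digraph n} →
  IsOrientation A → ¬ HasUndirectedCycle A → WellFounded A
orientedForest⇒wellFounded orient noCycle =
  directedAcyclic⇒wellFounded (orientedForest⇒directedAcyclic orient noCycle)

reverse-orientation : ∀ {n} {A : Digraph n} → IsOrientation (reverse A) → IsOrientation A
reverse-orientation (noLoop , noDigon) = noLoop , λ u v uv vu → noDigon u v vu uv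

reverse-cycle : ∀ {n} {A : Digraph n} → HasUndirectedCycle A → HasUndirectedCycle (reverse A)
reverse-cycle (x , xs , long , uniq , cycle) = x , xs , long , uniq , mapLinked swap cycle

∈-tabulate⁺ : ∀ {n} (f : Fin n → Bool) {v} → T (f v) → v ∈ tabulate f
∈-tabulate⁺ f {v} fv = lookup⇒[]= v (tabulate f) (trans (lookup∘tabulate f v) (Equivalence.to T-≡ fv))

∈-tabulate⁻ : ∀ {n} (f : Fin n → Bool) {v} → v ∈ tabulate f → T (f v)
∈-tabulate⁻ f {v} v∈ = Equivalence.from T-≡ (trans (sym (lookup∘tabulate f v)) ([]=⇒lookup v∈))

-- Two independent dominating sets agreeing on the in-neighbours of v agree
-- on v: if v ∈ S₁ but v ∉ S₂, the S₂-vertex dominating v lies in S₁ too,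
-- contradicting independence of S₁.
transfer : ∀ {n} {A : Digraph n} {S₁ S₂ v} → IsIndependent A S₁ → IsDominating A S₂ →
  (∀ {u} → A u v → u ∈ S₂ → u ∈ S₁) → v ∈ S₁ → v ∈ S₂
transfer {S₂ = S₂} {v} independent₁ dominating₂ agree v∈S₁ with v ∈? S₂
... | yes v∈S₂ = v∈S₂
... | no  v∉S₂ with u , u∈S₂ , uv ← dominating₂ v v∉S₂ =
  ⊥-elim (independent₁ _ v (agree uv u∈S₂) v∈S₁ uv)

independentDominating-unique : ∀ {n} {A : Digraph n} {S₁ S₂} → WellFounded A →
  IsIndependentDominating A S₁ → IsIndependentDominating A S₂ → S₁ ≡ S₂
independentDominating-unique {S₁ = S₁} {S₂} wf (independent₁ , dominating₁) (independent₂ , dominating₂) =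
  ⊆-antisym (proj₁ (agree _)) (proj₂ (agree _))
  where
  agree : ∀ v → (v ∈ S₁ → v ∈ S₂) × (v ∈ S₂ → v ∈ S₁)
  agree = WF.All.wfRec wf 0ℓ _ λ v IH →
    transfer independent₁ dominating₂ (proj₂ ∘ IH) ,
    transfer independent₂ dominating₁ (proj₁ ∘ IH)

module KernelConstruction {n} (A : Digraph n) (A? : Decidable A) (wf : WellFounded A) where

  inNeighbourInKernel : ∀ v → WfRec A (λ _ → Bool) v → Fin n → Bool
  inNeighbourInKernel v inK u with A? u v
  ... | yes uv = inK uv
  ... | no  _  = false

  step : ∀ v → WfRec A (λ _ → Bool) v → Bool
  step v inK = not (any (inNeighbourInKernel v inK) (allFin n))

  step-cong : ∀ v {inK inK′ : WfRec A (λ _ → Bool) v} →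
    (∀ {u} (uv : A u v) → inK uv ≡ inK′ uv) → step v inK ≡ step v inK′
  step-cong v {inK} {inK′} same = cong (not ∘ or) (map-cong pointwise (allFin n))
    where
    pointwise : ∀ u → inNeighbourInKernel v inK u ≡ inNeighbourInKernel v inK′ u
    pointwise u with A? u v
    ... | yes uv = same uv
    ... | no  _  = refl

  inKernel : Fin n → Bool
  inKernel = WF.All.wfRec wf 0ℓ (λ _ → Bool) step

  inKernel-unfold : ∀ v → inKernel v ≡ step v (λ {u} _ → inKernel u)
  inKernel-unfold v = FixPoint.unfold-wfRec wf (λ _ → Bool) step step-cong

  dominatedAt : ∀ v → Fin n → Bool
  dominatedAt v = inNeighbourInKernel v (λ {u} _ → inKernel u)

  dominatedAt⁺ : ∀ {u v} → A u v → T (inKernel u) → T (dominatedAt v u)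
  dominatedAt⁺ {u} {v} uv inU with A? u v
  ... | yes _   = inU
  ... | no  ¬uv = ⊥-elim (¬uv uv)

  dominatedAt⁻ : ∀ {u v} → T (dominatedAt v u) → A u v × T (inKernel u)
  dominatedAt⁻ {u} {v} dom with A? u v
  ... | yes uv = uv , dom

  kernel-independent : ∀ {u v} → T (inKernel v) → A u v → ¬ T (inKernel u)
  kernel-independent {u} {v} inV uv inU =
    T-not-elim (subst T (inKernel-unfold v) inV)
               (any⁺ (dominatedAt v) (lose (∈-allFin u) (dominatedAt⁺ uv inU)))
    where
    T-not-elim : ∀ {b} → T (not b) → ¬ T b
    T-not-elim {true} () _

  kernel-absorbing : ∀ {v} → ¬ T (inKernel v) → ∃ λ u → A u v × T (inKernel u)
  kernel-absorbing {v} outV =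
    let u , dom = satisfied (any⁻ (dominatedAt v) (allFin n) dominated) in u , dominatedAt⁻ dom
    where
    dominated : T (any (dominatedAt v) (allFin n))
    dominated with any (dominatedAt v) (allFin n) in eq
    ... | true  = _
    ... | false = outV (subst T (sym (trans (inKernel-unfold v) (cong not eq))) _)

  kernel : Subset n
  kernel = tabulate inKernel

  kernel-isIndependentDominating : IsIndependentDominating A kernel
  kernel-isIndependentDominating = independent , dominating
    where
    independent : IsIndependent A kernel
    independent u v u∈ v∈ uv =
      kernel-independent (∈-tabulate⁻ inKernel v∈) uv (∈-tabulate⁻ inKernel u∈)

    dominating : IsDominating A kernel
    dominating v v∉ with u , uv , inU ← kernel-absorbing (v∉ ∘ ∈-tabulate⁺ inKernel) =
      u , ∈-tabulate⁺ inKernel inU , uv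

wellFounded⇒uniqueIndependentDominating : ∀ {n} {A : Digraph n} →
  Decidable A → WellFounded A → ∃! _≡_ (IsIndependentDominating A)
wellFounded⇒uniqueIndependentDominating {A = A} A? wf =
  kernel , kernel-isIndependentDominating ,
  independentDominating-unique wf kernel-isIndependentDominating
  where open KernelConstruction A A? wf

mainTheorem8 : (n : ℕ) (A : Digraph n) → Decidable A →
    (Σ (Fin n) (λ r → IsArborescence A r) ⊎ Σ (Fin n) (λ r → IsAntiArborescence A r)) →
    ∃! _≡_ (IsIndependentDominating A)
mainTheorem8 n A A? (inj₁ (_ , orient , noCycle , _)) =
  wellFounded⇒uniqueIndependentDominating A? (orientedForest⇒wellFounded orient noCycle)
mainTheorem8 n A A? (inj₂ (_ , orient , noCycle , _)) =
  wellFounded⇒uniqueIndependentDominating A?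
    (orientedForest⇒wellFounded (reverse-orientation orient) (noCycle ∘ reverse-cycle))
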